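{- Let $m\ge1,n\ge0$ and identify $a_i=s_i$ ($1\le i\le m$), so $A=S\setminus\{s_0\}$. Define $\eta:\mathfrak{S\!C}_{m,n}^{\bullet}\to\mathfrak{A\!C}_{m,n}^{\bullet}$ by $\eta(R,T)=(R\cap(A\times C),\,T\cap(C\times A))$ and $\xi:\mathfrak{A\!C}_{m,n}^{\bullet}\to\mathfrak{S\!C}_{m,n}^{\bullet}$ by $\xi(R,T)=(R_o,T_o)$ with $R_o=R\cup\{(s_0,c_j):\exists i,\ (a_i,c_j)\in R\}$ and $T_o=T$ (these maps are well defined). Then $\eta$ is surjective and $\xi$ is injective.
   Context: For posets $(P,\le_P)$, $(Q,\le_Q)$ on disjoint ground sets and $R\subseteq P\times Q$, $T\subseteq Q\times P$, define $\le_{R,T}$ on $P\cup Q$ by: $x\le_{R,T}y$ iff $x\le_P y$, or $x\le_Q y$, or $(x,y)\in R$, or $(x,y)\in T$. $(R,T)$ is a merging if $\le_{R,T}$ is reflexive and transitive, and a proper merging if moreover $R\cap T^{ -1}=\emptyset$. The $m$-star is the poset on $S=\{s_0,\dots,s_m\}$ with $s\le s'$ iff $s=s'$ or $s=s_0$; the $m$-antichain is the poset on $A=\{a_1,\dots,a_m\}$ with only trivial relations; the $n$-chain is the poset on $C=\{c_1,\dots,c_n\}$ with $c_i\le c_j$ iff $i\le j$. $\mathfrak{S\!C}_{m,n}^{\bullet}$ is the set of proper mergings of the $m$-star and the $n$-chain, and $\mathfrak{A\!C}_{m,n}^{\bullet}$ the set of proper mergings of the $m$-antichain and the $n$-chain.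 -}

module Defs where

open import Data.Bool using (Bool; true; false; _∨_)
open import Data.Nat using (ℕ; zero; suc)
open import Data.Fin using (Fin; zero; suc) renaming (_≤_ to _≤F_)
open import Data.Sum using (_⊎_; inj₁; inj₂)
open import Data.Product using (_×_; _,_; proj₁; proj₂)
open import Data.Empty using (⊥)
open import Relation.Binary.PropositionalEquality using (_≡_)
open import Relation.Binary.Definitions using (Reflexive; Transitive)

Rels : Set → Set → Set
Rels P Q = (P → Q → Bool) × (Q → P → Bool)

mergeRel : {P Q : Set} → (P → P → Set) → (Q → Q → Set) → Rels P Q → P ⊎ Q → P ⊎ Q → Set
mergeRel ≤P ≤Q RT (inj₁ x) (inj₁ y) = ≤P x y
mergeRel ≤P ≤Q RT (inj₂ x) (inj₂ y) = ≤Q x y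
mergeRel ≤P ≤Q RT (inj₁ x) (inj₂ y) = proj₁ RT x y ≡ true
mergeRel ≤P ≤Q RT (inj₂ x) (inj₁ y) = proj₂ RT x y ≡ true

IsMerging : {P Q : Set} → (P → P → Set) → (Q → Q → Set) → Rels P Q → Set
IsMerging ≤P ≤Q RT = Reflexive (mergeRel ≤P ≤Q RT) × Transitive (mergeRel ≤P ≤Q RT)

IsProperMerging : {P Q : Set} → (P → P → Set) → (Q → Q → Set) → Rels P Q → Set
IsProperMerging ≤P ≤Q RT =
  IsMerging ≤P ≤Q RT × (∀ x y → proj₁ RT x y ≡ true → proj₂ RT y x ≡ true → ⊥)

-- m-star on S = Fin (suc m): zero is s₀, suc i is s_{i+1}
_≤star_ : {m : ℕ} → Fin (suc m) → Fin (suc m) → Set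
s ≤star s' = (s ≡ s') ⊎ (s ≡ zero)

-- m-antichain on A = Fin m: suc i of the star is identified with i of the antichain
_≤anti_ : {m : ℕ} → Fin m → Fin m → Set
a ≤anti a' = a ≡ a'

_≤chain_ : {n : ℕ} → Fin n → Fin n → Set
c ≤chain c' = c ≤F c'

SC : (m n : ℕ) → Rels (Fin (suc m)) (Fin n) → Set
SC m n = IsProperMerging (_≤star_ {m}) (_≤chain_ {n})

AC : (m n : ℕ) → Rels (Fin m) (Fin n) → Set
AC m n = IsProperMerging (_≤anti_ {m}) (_≤chain_ {n})

anyFin : {m : ℕ} → (Fin m → Bool) → Bool
anyFin {zero} f = false
anyFin {suc m} f = f zero ∨ anyFin (λ i → f (suc i))

η : {m n : ℕ} → Rels (Fin (suc m)) (Fin n) → Rels (Fin m) (Fin n)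
η (R , T) = (λ i j → R (suc i) j) , (λ j i → T j (suc i))

ξ : {m n : ℕ} → Rels (Fin m) (Fin n) → Rels (Fin (suc m)) (Fin n)
ξ {m} {n} (R , T) = Ro , To
  where
  Ro : Fin (suc m) → Fin n → Bool
  Ro zero j = anyFin (λ i → R i j)
  Ro (suc i) j = R i j
  To : Fin n → Fin (suc m) → Bool
  To j zero = false
  To j (suc i) = T j i

-- equality of relation pairs (pointwise, i.e. equality as sets of pairs)
_≋_ : {P Q : Set} → Rels P Q → Rels P Q → Set
RT ≋ RT' = (∀ x y → proj₁ RT x y ≡ proj₁ RT' x y) × (∀ y x → proj₂ RT y x ≡ proj₂ RT' y x)

module Submission where

-- Restricting a merging of P and Q to a subposet P' ⊆ P (more
-- generally, pulling it back along an order embedding P' → P) yields a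
-- merging of P' and Q, because ≤_{R,T} on P' ⊎ Q is exactly the restriction
-- of ≤_{R,T} on P ⊎ Q.  The antichain A is the subposet S ∖ {s₀} of the star
-- (embedded by suc), and η is this restriction, so η is well defined.
--
-- For ξ, the restriction of ξ(R,T) to A ⊎ C is (R,T) itself (η ∘ ξ = id,
-- definitionally), so transitivity of ≤_{ξ(R,T)} among points other than s₀ is
-- transitivity of ≤_{R,T}.  The apex s₀ is handled by two facts: no other
-- point lies below s₀, and everything above something above s₀ is above s₀
-- (for a chain element this uses that s₀ ≤ c_j holds iff some a_i ≤ c_j).
--
-- Finally η ∘ ξ = id makes η surjective (with section ξ) and ξ injective.

open import Defs
open import Data.Nat using (ℕ; suc; _≤_)
open import Data.Fin using (Fin; zero; suc)
open import Data.Fin.Properties using (suc-injective)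
open import Data.Product using (_×_; Σ; _,_; proj₁; proj₂)
open import Data.Sum using (_⊎_; inj₁; inj₂; map₁)
open import Data.Bool using (Bool; true; false)
open import Data.Empty using (⊥)
open import Relation.Nullary using (¬_)
open import Relation.Binary.PropositionalEquality using (_≡_; refl; cong)

anyFin-witness : {m : ℕ} (f : Fin m → Bool) → anyFin f ≡ true → Σ (Fin m) (λ i → f i ≡ true)
anyFin-witness {suc m} f any with f zero in f0
... | true = zero , f0
... | false with anyFin-witness (λ i → f (suc i)) any
...   | i , fi = suc i , fi

anyFin-intro : {m : ℕ} (f : Fin m → Bool) (i : Fin m) → f i ≡ true → anyFin f ≡ true
anyFin-intro f zero fi rewrite fi = refl
anyFin-intro f (suc i) fi with f zero
... | true = refl
... | false = anyFin-intro (λ k → f (suc k)) i fi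

restrict : {P P' Q : Set} → (P' → P) → Rels P Q → Rels P' Q
restrict e (R , T) = (λ x y → R (e x) y) , (λ y x → T y (e x))

module Restriction {P P' Q : Set}
  (_≤P_ : P → P → Set) (_≤P'_ : P' → P' → Set) (_≤Q_ : Q → Q → Set)
  (e : P' → P)
  (preserves : ∀ {x y} → x ≤P' y → e x ≤P e y)
  (reflects : ∀ {x y} → e x ≤P e y → x ≤P' y)
  (p : Rels P Q) where

  private
    _⊑_ : P ⊎ Q → P ⊎ Q → Set
    _⊑_ = mergeRel _≤P_ _≤Q_ p
    _⊑'_ : P' ⊎ Q → P' ⊎ Q → Set
    _⊑'_ = mergeRel _≤P'_ _≤Q_ (restrict e p)

  restrict-to : ∀ x y → x ⊑' y → map₁ e x ⊑ map₁ e y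
  restrict-to (inj₁ x) (inj₁ y) x≤y = preserves x≤y
  restrict-to (inj₁ x) (inj₂ y) x≤y = x≤y
  restrict-to (inj₂ x) (inj₁ y) x≤y = x≤y
  restrict-to (inj₂ x) (inj₂ y) x≤y = x≤y

  restrict-from : ∀ x y → map₁ e x ⊑ map₁ e y → x ⊑' y
  restrict-from (inj₁ x) (inj₁ y) x≤y = reflects x≤y
  restrict-from (inj₁ x) (inj₂ y) x≤y = x≤y
  restrict-from (inj₂ x) (inj₁ y) x≤y = x≤y
  restrict-from (inj₂ x) (inj₂ y) x≤y = x≤y

  restrict-proper : IsProperMerging _≤P_ _≤Q_ p → IsProperMerging _≤P'_ _≤Q_ (restrict e p)
  restrict-proper ((refl≤ , trans≤) , disjoint) =
    ( (λ {x} → restrict-from x x (refl≤ {map₁ e x}))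
    , (λ {x} {y} {z} x≤y y≤z → restrict-from x z
         (trans≤ {map₁ e x} {map₁ e y} {map₁ e z} (restrict-to x y x≤y) (restrict-to y z y≤z))) )
    , (λ x y → disjoint (e x) y)

suc-preserves : {m : ℕ} {i j : Fin m} → i ≤anti j → suc i ≤star suc j
suc-preserves i≡j = inj₁ (cong suc i≡j)

suc-reflects : {m : ℕ} {i j : Fin m} → suc i ≤star suc j → i ≤anti j
suc-reflects (inj₁ si≡sj) = suc-injective si≡sj

module StarRestriction {m n : ℕ} =
  Restriction (_≤star_ {m}) (_≤anti_ {m}) (_≤chain_ {n}) suc suc-preserves suc-reflects

η-proper : (m n : ℕ) (p : Rels (Fin (suc m)) (Fin n)) → SC m n p → AC m n (η p)
η-proper m n p = StarRestriction.restrict-proper p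

η∘ξ : {m n : ℕ} (q : Rels (Fin m) (Fin n)) → η (ξ q) ≋ q
η∘ξ q = (λ i j → refl) , (λ j i → refl)

η-cong : {m n : ℕ} {p p' : Rels (Fin (suc m)) (Fin n)} → p ≋ p' → η p ≋ η p'
η-cong (R≗R' , T≗T') = (λ i j → R≗R' (suc i) j) , (λ j i → T≗T' j (suc i))

data StarPoint {m n : ℕ} : Fin (suc m) ⊎ Fin n → Set where
  apex : StarPoint (inj₁ zero)
  lifted : (x : Fin m ⊎ Fin n) → StarPoint (map₁ suc x)

starPoint : {m n : ℕ} (x : Fin (suc m) ⊎ Fin n) → StarPoint x
starPoint (inj₁ zero) = apex
starPoint (inj₁ (suc i)) = lifted (inj₁ i)
starPoint (inj₂ j) = lifted (inj₂ j)

module XiMerging {m n : ℕ} (q : Rels (Fin m) (Fin n)) (ac : AC m n q) where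

  private
    _⊑_ : Fin (suc m) ⊎ Fin n → Fin (suc m) ⊎ Fin n → Set
    _⊑_ = mergeRel (_≤star_ {m}) (_≤chain_ {n}) (ξ q)
    _⊑A_ : Fin m ⊎ Fin n → Fin m ⊎ Fin n → Set
    _⊑A_ = mergeRel (_≤anti_ {m}) (_≤chain_ {n}) q
    s₀ : Fin (suc m) ⊎ Fin n
    s₀ = inj₁ zero
    reflA : ∀ x → x ⊑A x
    reflA x = proj₁ (proj₁ ac) {x}
    transA : ∀ x y z → x ⊑A y → y ⊑A z → x ⊑A z
    transA x y z = proj₂ (proj₁ ac) {x} {y} {z}
    open StarRestriction {m} {n} (ξ q)

  -- Only s₀ lies below s₀: ξ adds no pair (c_j , s₀).
  nothing-below-apex : ∀ x → ¬ (map₁ suc x ⊑ s₀)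
  nothing-below-apex (inj₁ i) (inj₁ ())
  nothing-below-apex (inj₁ i) (inj₂ ())
  nothing-below-apex (inj₂ j) ()

  -- The up-set of s₀ is closed upwards; s₀ ≤ c_j is witnessed by some a_i ≤ c_j.
  apex-trans : ∀ y z → s₀ ⊑ y → y ⊑ z → s₀ ⊑ z
  apex-trans y (inj₁ k) _ _ = inj₂ refl
  apex-trans (inj₁ zero) (inj₂ c) _ s₀≤c = s₀≤c
  apex-trans (inj₁ (suc i)) (inj₂ c) _ aᵢ≤c = anyFin-intro (λ k → proj₁ q k c) i aᵢ≤c
  apex-trans (inj₂ c') (inj₂ c) s₀≤c' c'≤c with anyFin-witness (λ k → proj₁ q k c') s₀≤c'
  ... | i , aᵢ≤c' =
    anyFin-intro (λ k → proj₁ q k c) i (transA (inj₁ i) (inj₂ c') (inj₂ c) aᵢ≤c' c'≤c)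

  ξ-refl : ∀ x → x ⊑ x
  ξ-refl x with starPoint x
  ... | apex = inj₁ refl
  ... | lifted x' = restrict-to x' x' (reflA x')

  -- Away from s₀, transitivity is that of ≤_{R,T}, since η (ξ q) = q.
  ξ-trans : ∀ x y z → x ⊑ y → y ⊑ z → x ⊑ z
  ξ-trans x y z x≤y y≤z with starPoint x | starPoint y | starPoint z
  ... | apex | _ | _ = apex-trans y z x≤y y≤z
  ... | lifted x' | apex | _ with () ← nothing-below-apex x' x≤y
  ... | lifted x' | lifted y' | apex with () ← nothing-below-apex y' y≤z
  ... | lifted x' | lifted y' | lifted z' =
    restrict-to x' z' (transA x' y' z' (restrict-from x' y' x≤y) (restrict-from y' z' y≤z))

  ξ-disjoint : ∀ s c → proj₁ (ξ q) s c ≡ true → proj₂ (ξ q) c s ≡ true → ⊥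
  ξ-disjoint zero c _ ()
  ξ-disjoint (suc i) c = proj₂ ac i c

  ξ-proper : SC m n (ξ q)
  ξ-proper = ((λ {x} → ξ-refl x) , (λ {x} {y} {z} → ξ-trans x y z)) , ξ-disjoint

lemma3p4 : (m n : ℕ) → 1 ≤ m →
    -- η and ξ are well defined
    ((p : Rels (Fin (suc m)) (Fin n)) → SC m n p → AC m n (η p)) ×
    ((q : Rels (Fin m) (Fin n)) → AC m n q → SC m n (ξ q)) ×
    -- η is surjective
    ((q : Rels (Fin m) (Fin n)) → AC m n q →
      Σ (Rels (Fin (suc m)) (Fin n)) (λ p → SC m n p × (η p ≋ q))) ×
    -- ξ is injective
    ((q q' : Rels (Fin m) (Fin n)) → AC m n q → AC m n q' → ξ q ≋ ξ q' → q ≋ q')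
lemma3p4 m n _ = η-proper m n , ξ-proper , η-surjective , ξ-injective
  where
  ξ-proper : (q : Rels (Fin m) (Fin n)) → AC m n q → SC m n (ξ q)
  ξ-proper q ac = XiMerging.ξ-proper q ac

  η-surjective : (q : Rels (Fin m) (Fin n)) → AC m n q →
    Σ (Rels (Fin (suc m)) (Fin n)) (λ p → SC m n p × (η p ≋ q))
  η-surjective q ac = ξ q , ξ-proper q ac , η∘ξ q

  -- Apply η to both sides; η (ξ q) is definitionally q (see η∘ξ).
  ξ-injective : (q q' : Rels (Fin m) (Fin n)) → AC m n q → AC m n q' → ξ q ≋ ξ q' → q ≋ q'
  ξ-injective q q' _ _ ξq≋ξq' = η-cong ξq≋ξq'
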